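{- For every tree $T$ with $|T|\ge2$ vertices, $\beta(T)\le\frac23\big(|T|+|\mathit{Deg}_1(T)|-|\mathit{Supp}(T)|\big)$.
   Context: $\beta(T)$ is the size of a maximum independent set of $T$. $\mathit{Deg}_1(T)$ is the set of leaves (degree-$1$ vertices) of $T$; $\mathit{Supp}(T)$ is the set of support vertices, i.e., vertices adjacent to at least one leaf. -}

module Defs where

open import Data.Nat using (ℕ; zero; suc; _+_; _*_; _≤_; _≡ᵇ_)
open import Data.Bool using (Bool; true; false; _∧_; _∨_)
open import Data.Fin using (Fin; zero; suc; inject₁; fromℕ)
open import Data.Fin.Subset using (Subset; ∣_∣; _∈_)
open import Data.Vec using (Vec; tabulate; foldr)
open import Data.Product using (Σ; ∃; _×_)
open import Relation.Binary.PropositionalEquality using (_≡_)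
open import Relation.Nullary using (¬_)
open import Function.Definitions using (Injective)

record Graph (n : ℕ) : Set where
  field
    adj       : Fin n → Fin n → Bool
    symmetric : ∀ i j → adj i j ≡ adj j i
    irrefl    : ∀ i → adj i i ≡ false
open Graph public

data Walk {n : ℕ} (G : Graph n) : Fin n → Fin n → Set where
  here : ∀ {u} → Walk G u u
  step : ∀ {u w v} → adj G u w ≡ true → Walk G w v → Walk G u v

Connected : ∀ {n} → Graph n → Set
Connected G = ∀ u v → Walk G u v

-- A cycle of length k+3: injective cyclic sequence of vertices with
-- consecutive vertices adjacent.
record Cycle {n : ℕ} (G : Graph n) : Set where
  field
    len     : ℕ
    vert    : Fin (suc (suc (suc len))) → Fin n
    distinct : Injective _≡_ _≡_ vert
    consec  : ∀ (i : Fin (suc (suc len))) → adj G (vert (inject₁ i)) (vert (suc i)) ≡ true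
    closing : adj G (vert (fromℕ (suc (suc len)))) (vert zero) ≡ true

Acyclic : ∀ {n} → Graph n → Set
Acyclic G = ¬ Cycle G

IsTree : ∀ {n} → Graph n → Set
IsTree G = Connected G × Acyclic G

degree : ∀ {n} → Graph n → Fin n → ℕ
degree G i = ∣ tabulate (adj G i) ∣

isLeaf : ∀ {n} → Graph n → Fin n → Bool
isLeaf G i = degree G i ≡ᵇ 1

anyFin : ∀ {n} → (Fin n → Bool) → Bool
anyFin p = foldr _ _∨_ false (tabulate p)

Deg₁ : ∀ {n} → Graph n → Subset n
Deg₁ G = tabulate (isLeaf G)

Supp : ∀ {n} → Graph n → Subset n
Supp G = tabulate (λ i → anyFin (λ j → adj G i j ∧ isLeaf G j))

Independent : ∀ {n} → Graph n → Subset n → Set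
Independent G S = ∀ i j → i ∈ S → j ∈ S → adj G i j ≡ false

record IsMaxIndep {n : ℕ} (G : Graph n) (b : ℕ) : Set where
  field
    witness    : Subset n
    indep      : Independent G witness
    size       : ∣ witness ∣ ≡ b
    maximum    : ∀ S → Independent G S → ∣ S ∣ ≤ b

-- Let I be an independent set, L the set of leaves and S the set of supports. A leaf has a
-- single neighbour, so sending each support to a leaf neighbour is injective: |S| ≤ |L|, and
-- |S ∩ I| ≤ |L ─ I| because the leaf neighbour of a support in I lies outside I. The key
-- estimate is |I ─ L| ≤ |∁ I|: every non-leaf of I has at least two neighbours, all in ∁ I,
-- so the forest induced on (I ─ L) ∪ ∁ I has at least 2 |I ─ L| edges, whereas a forest has
-- fewer edges than vertices. The theorem is a nonnegative combination of these inequalities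
-- and |S ─ I| ≤ |∁ I|.

module Submission where

open import Defs
open import Data.Bool using (Bool; true; false; _∧_; _∨_; not; T)
import Data.Bool as Bool
open import Data.Bool.Properties using (∧-zeroʳ; ∧-identityʳ; ∨-zeroʳ; ∧-comm)
open import Data.Fin using (Fin; zero; suc; toℕ; fromℕ<; inject₁; fromℕ; punchIn)
open import Data.Fin.Properties
  using (_≟_; any?; pigeonhole; toℕ-fromℕ<; toℕ-injective; toℕ<n; toℕ-inject₁; toℕ-fromℕ; punchInᵢ≢i)
open import Data.Fin.Subset using (∣_∣)
open import Data.Nat using (ℕ; zero; suc; _+_; _*_; _≤_; _<_; z≤n; s≤s; z<s; _≤?_)
open import Data.Nat.Properties hiding (_≟_)
open import Algebra.Properties.CommutativeSemigroup *-commutativeSemigroup using (x∙yz≈y∙xz)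
open import Algebra.Properties.Semiring.Sum +-*-semiring
  using (sum; sum-cong-≗; sum-replicate-zero; ∑-distrib-+; ∑-comm; *-distribˡ-sum)
open import Data.Nat.Tactic.RingSolver using (solve-∀)
open import Data.Product using (Σ; ∃; _×_; _,_; proj₁; proj₂)
open import Data.Sum using (_⊎_; inj₁; inj₂; [_,_]′)
open import Data.Unit using (tt)
open import Data.Vec using (tabulate; lookup)
open import Data.Vec.Properties using (tabulate∘lookup; lookup⇒[]=)
open import Function using (_∘_)
open import Relation.Binary.Definitions using (tri<; tri≈; tri>)
open import Relation.Binary.PropositionalEquality
open import Relation.Nullary using (¬_; does; yes; no; contradiction; _×-dec_; ¬?)
open import Relation.Unary using (Decidable)

-- Sums over vertex sets

-- Vertex sets are Boolean predicates, so that cardinalities are sums of indicators and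
-- double counting is ∑-comm.
χ : Bool → ℕ
χ true  = 1
χ false = 0

sumOver : ∀ {n} → (Fin n → Bool) → (Fin n → ℕ) → ℕ
sumOver X f = sum (λ u → χ (X u) * f u)

card : ∀ {n} → (Fin n → Bool) → ℕ
card X = sumOver X (λ _ → 1)

_∪_ _∩_ _─_ : ∀ {n} → (Fin n → Bool) → (Fin n → Bool) → Fin n → Bool
(X ∪ Y) u = X u ∨ Y u
(X ∩ Y) u = X u ∧ Y u
(X ─ Y) u = X u ∧ not (Y u)

∁ : ∀ {n} → (Fin n → Bool) → Fin n → Bool
∁ X u = not (X u)

⁅_⁆ : ∀ {n} → Fin n → Fin n → Bool
⁅ v ⁆ u = does (u ≟ v)

∩-true : ∀ {n} (X Y : Fin n → Bool) {u} → (X ∩ Y) u ≡ true → X u ≡ true × Y u ≡ true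
∩-true X Y {u} X∩Yu with X u | Y u
... | true | true = refl , refl

─-true : ∀ {n} (X Y : Fin n → Bool) {u} → (X ─ Y) u ≡ true → X u ≡ true × Y u ≡ false
─-true X Y {u} X─Yu with X u | Y u
... | true | false = refl , refl

sum-mono-≤ : ∀ {n} {f g : Fin n → ℕ} → (∀ i → f i ≤ g i) → sum f ≤ sum g
sum-mono-≤ {zero}  _   = z≤n
sum-mono-≤ {suc n} f≤g = +-mono-≤ (f≤g zero) (sum-mono-≤ (f≤g ∘ suc))

≤-sum : ∀ {n} (f : Fin n → ℕ) i → f i ≤ sum f
≤-sum f zero    = m≤m+n _ _
≤-sum f (suc i) = ≤-trans (≤-sum (f ∘ suc) i) (m≤n+m _ _)

sumOver-⁅⁆ : ∀ {n} (v : Fin n) f → sumOver ⁅ v ⁆ f ≡ f v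
sumOver-⁅⁆ {suc n} zero    f =
  trans (cong (1 * f zero +_) (sum-replicate-zero n)) (trans (+-identityʳ _) (*-identityˡ _))
sumOver-⁅⁆ {suc n} (suc v) f = sumOver-⁅⁆ v (f ∘ suc)

sumOver-comm : ∀ {m n} (X : Fin m → Bool) (Y : Fin n → Bool) (R : Fin m → Fin n → ℕ) →
               sumOver X (λ u → sumOver Y (R u)) ≡ sumOver Y (λ w → sumOver X (λ u → R u w))
sumOver-comm X Y R = begin
  sum (λ u → χ (X u) * sum (λ w → χ (Y w) * R u w))
    ≡⟨ sum-cong-≗ (λ u → *-distribˡ-sum (χ (X u)) (λ w → χ (Y w) * R u w)) ⟩
  sum (λ u → sum (λ w → χ (X u) * (χ (Y w) * R u w)))
    ≡⟨ ∑-comm (λ u w → χ (X u) * (χ (Y w) * R u w)) ⟩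
  sum (λ w → sum (λ u → χ (X u) * (χ (Y w) * R u w)))
    ≡⟨ sum-cong-≗ (λ w → sum-cong-≗ λ u → x∙yz≈y∙xz (χ (X u)) (χ (Y w)) (R u w)) ⟩
  sum (λ w → sum (λ u → χ (Y w) * (χ (X u) * R u w)))
    ≡⟨ sum-cong-≗ (λ w → *-distribˡ-sum (χ (Y w)) (λ u → χ (X u) * R u w)) ⟨
  sum (λ w → χ (Y w) * sum (λ u → χ (X u) * R u w)) ∎
  where open ≡-Reasoning

card-⊤ : ∀ n → card {n} (λ _ → true) ≡ n
card-⊤ zero    = refl
card-⊤ (suc n) = cong suc (card-⊤ n)

card-tabulate : ∀ {n} (X : Fin n → Bool) → ∣ tabulate X ∣ ≡ card X
card-tabulate {zero}  X = refl
card-tabulate {suc n} X with X zero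
... | true  = cong suc (card-tabulate (X ∘ suc))
... | false = card-tabulate (X ∘ suc)

module _ {n : ℕ} where

  sumOver-cong : ∀ (X : Fin n → Bool) {f g} → (∀ u → X u ≡ true → f u ≡ g u) →
                 sumOver X f ≡ sumOver X g
  sumOver-cong X {f} {g} f≗g = sum-cong-≗ pointwise
    where
    pointwise : ∀ u → χ (X u) * f u ≡ χ (X u) * g u
    pointwise u with X u in Xu
    ... | true  = cong (1 *_) (f≗g u Xu)
    ... | false = refl

  sumOver-congˡ : ∀ {X Y : Fin n → Bool} f → (∀ u → X u ≡ Y u) → sumOver X f ≡ sumOver Y f
  sumOver-congˡ f X≗Y = sum-cong-≗ (λ u → cong (λ b → χ b * f u) (X≗Y u))

  sumOver-mono-≤ : ∀ (X : Fin n → Bool) {f g} →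
                   (∀ u → X u ≡ true → f u ≤ g u) → sumOver X f ≤ sumOver X g
  sumOver-mono-≤ X {f} {g} f≤g = sum-mono-≤ pointwise
    where
    pointwise : ∀ u → χ (X u) * f u ≤ χ (X u) * g u
    pointwise u with X u in Xu
    ... | true  = *-monoʳ-≤ 1 (f≤g u Xu)
    ... | false = z≤n

  card-⊆ : ∀ (X Y : Fin n → Bool) → (∀ u → X u ≡ true → Y u ≡ true) → card X ≤ card Y
  card-⊆ X Y X⊆Y = sum-mono-≤ pointwise
    where
    pointwise : ∀ u → χ (X u) * 1 ≤ χ (Y u) * 1
    pointwise u with X u in Xu
    ... | true  rewrite X⊆Y u Xu = ≤-refl
    ... | false = z≤n

  ≤-sumOver : ∀ (X : Fin n → Bool) f {v} → X v ≡ true → f v ≤ sumOver X f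
  ≤-sumOver X f {v} Xv = ≤-trans (≤-reflexive (sym (trans (cong (λ b → χ b * f v) Xv) (*-identityˡ _))))
                                   (≤-sum (λ u → χ (X u) * f u) v)

  sumOver-+ : ∀ (X : Fin n → Bool) f g →
              sumOver X (λ u → f u + g u) ≡ sumOver X f + sumOver X g
  sumOver-+ X f g = trans (sum-cong-≗ (λ u → *-distribˡ-+ (χ (X u)) (f u) (g u)))
                          (∑-distrib-+ (λ u → χ (X u) * f u) (λ u → χ (X u) * g u))

  *-distribˡ-sumOver : ∀ c (X : Fin n → Bool) f → c * sumOver X f ≡ sumOver X (λ u → c * f u)
  *-distribˡ-sumOver c X f = trans (*-distribˡ-sum c (λ u → χ (X u) * f u))
                                   (sum-cong-≗ λ u → x∙yz≈y∙xz c (χ (X u)) (f u))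

  sumOver-split : ∀ (X Y : Fin n → Bool) f → sumOver X f ≡ sumOver (X ∩ Y) f + sumOver (X ─ Y) f
  sumOver-split X Y f = trans (sum-cong-≗ pointwise)
                              (∑-distrib-+ (λ u → χ ((X ∩ Y) u) * f u) (λ u → χ ((X ─ Y) u) * f u))
    where
    pointwise : ∀ u → χ (X u) * f u ≡ χ (X u ∧ Y u) * f u + χ (X u ∧ not (Y u)) * f u
    pointwise u with X u | Y u
    ... | true  | true  = sym (+-identityʳ _)
    ... | true  | false = refl
    ... | false | _     = refl

  sumOver-remove : ∀ (X : Fin n → Bool) {v} f → X v ≡ true → sumOver X f ≡ f v + sumOver (X ─ ⁅ v ⁆) f
  sumOver-remove X {v} f Xv = begin
    sumOver X f
      ≡⟨ sumOver-split X ⁅ v ⁆ f ⟩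
    sumOver (X ∩ ⁅ v ⁆) f + sumOver (X ─ ⁅ v ⁆) f
      ≡⟨ cong (_+ sumOver (X ─ ⁅ v ⁆) f) (sumOver-congˡ f X∩v≗v) ⟩
    sumOver ⁅ v ⁆ f + sumOver (X ─ ⁅ v ⁆) f
      ≡⟨ cong (_+ sumOver (X ─ ⁅ v ⁆) f) (sumOver-⁅⁆ v f) ⟩
    f v + sumOver (X ─ ⁅ v ⁆) f ∎
    where
    open ≡-Reasoning
    X∩v≗v : ∀ u → X u ∧ ⁅ v ⁆ u ≡ ⁅ v ⁆ u
    X∩v≗v u with u ≟ v
    ... | yes refl = cong (_∧ true) Xv
    ... | no  _    = ∧-zeroʳ (X u)

  card-remove : ∀ (X : Fin n → Bool) {v} → X v ≡ true → card X ≡ suc (card (X ─ ⁅ v ⁆))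
  card-remove X Xv = sumOver-remove X (λ _ → 1) Xv

  card-∩ : ∀ (X Y : Fin n → Bool) → card (X ∩ Y) ≡ sumOver X (χ ∘ Y)
  card-∩ X Y = sum-cong-≗ pointwise
    where
    pointwise : ∀ u → χ (X u ∧ Y u) * 1 ≡ χ (X u) * χ (Y u)
    pointwise u with X u | Y u
    ... | true  | true  = refl
    ... | true  | false = refl
    ... | false | _     = refl

  sumOver-∅ : ∀ {X : Fin n → Bool} f → (∀ u → X u ≡ false) → sumOver X f ≡ 0
  sumOver-∅ f X≗∅ = trans (sumOver-congˡ f X≗∅) (sum-replicate-zero n)

  card≡0⇒sumOver≡0 : ∀ (X : Fin n → Bool) f → card X ≡ 0 → sumOver X f ≡ 0
  card≡0⇒sumOver≡0 X f ∣X∣≡0 = sumOver-∅ f X≗∅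
    where
    X≗∅ : ∀ u → X u ≡ false
    X≗∅ u with X u in Xu
    ... | true  = contradiction (subst (1 ≤_) ∣X∣≡0 (≤-sumOver X (λ _ → 1) Xu)) λ ()
    ... | false = refl

  card>0⇒nonempty : ∀ (X : Fin n → Bool) → 0 < card X → ∃ λ u → X u ≡ true
  card>0⇒nonempty X ∣X∣>0 with any? (λ u → X u Bool.≟ true)
  ... | yes X≢∅ = X≢∅
  ... | no  X≡∅ = contradiction (sumOver-∅ (λ _ → 1) X≗∅) (>⇒≢ ∣X∣>0)
    where
    X≗∅ : ∀ u → X u ≡ false
    X≗∅ u with X u in Xu
    ... | true  = contradiction (u , Xu) X≡∅
    ... | false = refl

card-≤-by-partner : ∀ {m n} {P : Fin m → Bool} {Q : Fin n → Bool} (R : Fin m → Fin n → Bool) →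
                    (∀ x → P x ≡ true → ∃ λ y → Q y ≡ true × R x y ≡ true) →
                    (∀ y → Q y ≡ true → card (λ x → P x ∧ R x y) ≤ 1) →
                    card P ≤ card Q
card-≤-by-partner {P = P} {Q} R partner unique = begin
  card P
    ≤⟨ sumOver-mono-≤ P has-partner ⟩
  sumOver P (λ x → sumOver Q (λ y → χ (R x y)))
    ≡⟨ sumOver-comm P Q (λ x y → χ (R x y)) ⟩
  sumOver Q (λ y → sumOver P (λ x → χ (R x y)))
    ≡⟨ sumOver-cong Q (λ y _ → card-∩ P (λ x → R x y)) ⟨
  sumOver Q (λ y → card (λ x → P x ∧ R x y))
    ≤⟨ sumOver-mono-≤ Q unique ⟩
  card Q ∎
  where
  open ≤-Reasoning
  has-partner : ∀ x → P x ≡ true → 1 ≤ sumOver Q (λ y → χ (R x y))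
  has-partner x Px with partner x Px
  ... | y , Qy , Rxy = ≤-trans (≤-reflexive (cong χ (sym Rxy))) (≤-sumOver Q (λ y → χ (R x y)) Qy)

-- Non-backtracking walks

least-witness : ∀ {p} {P : ℕ → Set p} → Decidable P → ∀ {j} → P j →
                ∃ λ k → P k × (∀ {i} → i < k → ¬ P i)
least-witness {P = P} P? {j} Pj =
  [ (λ least → least) , (λ none → contradiction Pj (none (n<1+n j))) ]′ (scan (suc j))
  where
  scan : ∀ m → (∃ λ k → P k × (∀ {i} → i < k → ¬ P i)) ⊎ (∀ {i} → i < m → ¬ P i)
  scan zero = inj₂ λ ()
  scan (suc m) with scan m
  ... | inj₁ least = inj₁ least
  ... | inj₂ none-below-m with P? m
  ...   | yes Pm = inj₁ (m , Pm , none-below-m)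
  ...   | no ¬Pm = inj₂ λ i<1+m → [ none-below-m , (λ { refl → ¬Pm }) ]′ (m<1+n⇒m<n∨m≡n i<1+m)

record NonBacktrackingWalk {n : ℕ} (G : Graph n) : Set where
  field
    vertex          : ℕ → Fin n
    adjacent        : ∀ k → adj G (vertex k) (vertex (suc k)) ≡ true
    nonBacktracking : ∀ k → vertex (suc (suc k)) ≢ vertex k

module _ {n : ℕ} {G : Graph n} (W : NonBacktrackingWalk G) where
  open NonBacktrackingWalk W

  Revisit : ℕ → Set
  Revisit j = ∃ λ (i : Fin j) → vertex (toℕ i) ≡ vertex j

  revisit : ∀ {i j} → i < j → vertex i ≡ vertex j → Revisit j
  revisit i<j same = fromℕ< i<j , trans (cong vertex (toℕ-fromℕ< i<j)) same

  revisit? : Decidable Revisit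
  revisit? j = any? λ i → vertex (toℕ i) ≟ vertex j

  closedSegment⇒cycle : ∀ {i j} → i < j → vertex i ≡ vertex j →
                        (∀ {a b} → a < j → b < j → vertex a ≡ vertex b → a ≡ b) → Cycle G
  closedSegment⇒cycle {i} {j} i<j closes injective with m≤n⇒∃[o]m+o≡n i<j
  ... | zero , refl = contradiction (trans (sym loop) (irrefl G (vertex i))) λ ()
    where
    loop : adj G (vertex i) (vertex i) ≡ true
    loop = subst (λ w → adj G (vertex i) w ≡ true)
                 (sym (trans closes (cong vertex (+-identityʳ (suc i))))) (adjacent i)
  ... | suc zero , refl = contradiction (trans (cong vertex (cong suc (+-comm 1 i))) (sym closes)) (nonBacktracking i)
  ... | suc (suc len) , refl = record
    { len = len ; vert = vert ; distinct = distinct ; consec = consec ; closing = closing }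
    where
    vert : Fin (suc (suc (suc len))) → Fin n
    vert m = vertex (i + toℕ m)
    distinct : ∀ {x y} → vert x ≡ vert y → x ≡ y
    distinct {x} {y} same = toℕ-injective (+-cancelˡ-≡ i _ _ (injective (inSegment x) (inSegment y) same))
      where
      inSegment : ∀ m → i + toℕ m < suc i + suc (suc len)
      inSegment m = subst (i + toℕ m <_) (+-suc i (suc (suc len))) (+-monoʳ-< i (toℕ<n m))
    consec : ∀ m → adj G (vert (inject₁ m)) (vert (suc m)) ≡ true
    consec m rewrite toℕ-inject₁ m | +-suc i (toℕ m) = adjacent (i + toℕ m)
    closing : adj G (vert (fromℕ (suc (suc len)))) (vert zero) ≡ true
    closing rewrite toℕ-fromℕ (suc (suc len)) | +-identityʳ i =
      subst (λ w → adj G (vertex (i + suc (suc len))) w ≡ true) (sym closes) (adjacent (i + suc (suc len)))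

  walk⇒cycle : Cycle G
  walk⇒cycle with pigeonhole (n<1+n n) (λ (i : Fin (suc n)) → vertex (toℕ i))
  ... | i , j , i<j , same with least-witness revisit? (revisit i<j same)
  ... | k , (i′ , closes) , first = closedSegment⇒cycle (toℕ<n i′) closes injective
    where
    injective : ∀ {a b} → a < k → b < k → vertex a ≡ vertex b → a ≡ b
    injective {a} {b} a<k b<k same′ with <-cmp a b
    ... | tri< a<b _ _ = contradiction (revisit a<b same′) (first b<k)
    ... | tri≈ _ a≡b _ = a≡b
    ... | tri> _ _ b<a = contradiction (revisit b<a (sym same′)) (first a<k)

-- Degree sums and forests

module _ {n : ℕ} (G : Graph n) where

  deg : Fin n → ℕ
  deg u = card (adj G u)

  degIn : (Fin n → Bool) → Fin n → ℕ
  degIn X u = card (X ∩ adj G u)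

  -- twice the number of edges of the subgraph induced by X
  degSum : (Fin n → Bool) → ℕ
  degSum X = sumOver X (degIn X)

  sumOver-degIn-comm : ∀ Y Z → sumOver Y (degIn Z) ≡ sumOver Z (degIn Y)
  sumOver-degIn-comm Y Z = begin
    sumOver Y (degIn Z)
      ≡⟨ sumOver-cong Y (λ u _ → card-∩ Z (adj G u)) ⟩
    sumOver Y (λ u → sumOver Z (λ w → χ (adj G u w)))
      ≡⟨ sumOver-comm Y Z (λ u w → χ (adj G u w)) ⟩
    sumOver Z (λ w → sumOver Y (λ u → χ (adj G u w)))
      ≡⟨ sumOver-cong Z (λ w _ → sumOver-cong Y λ u _ → cong χ (symmetric G u w)) ⟩
    sumOver Z (λ w → sumOver Y (λ u → χ (adj G w u)))
      ≡⟨ sumOver-cong Z (λ w _ → card-∩ Y (adj G w)) ⟨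
    sumOver Z (degIn Y) ∎
    where open ≡-Reasoning

  degIn-⊆ : ∀ {X Y} u → (∀ w → X w ≡ true → Y w ≡ true) → degIn X u ≤ degIn Y u
  degIn-⊆ {X} {Y} u X⊆Y = card-⊆ (X ∩ adj G u) (Y ∩ adj G u) X∩A⊆Y∩A
    where
    X∩A⊆Y∩A : ∀ w → X w ∧ adj G u w ≡ true → Y w ∧ adj G u w ≡ true
    X∩A⊆Y∩A w with X w in Xw
    ... | true  rewrite X⊆Y w Xw = λ A → A
    ... | false = λ ()

  degIn-⊇-neighbours : ∀ {X} u → (∀ w → adj G u w ≡ true → X w ≡ true) → degIn X u ≡ deg u
  degIn-⊇-neighbours {X} u N⊆X = sumOver-congˡ (λ _ → 1) X∩N≗N
    where
    X∩N≗N : ∀ w → X w ∧ adj G u w ≡ adj G u w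
    X∩N≗N w with adj G u w in A
    ... | true  = cong (_∧ true) (N⊆X w A)
    ... | false = ∧-zeroʳ (X w)

  degIn-remove : ∀ X {v} u → X v ≡ true → degIn X u ≡ χ (adj G u v) + degIn (X ─ ⁅ v ⁆) u
  degIn-remove X {v} u Xv = begin
    degIn X u
      ≡⟨ card-∩ X (adj G u) ⟩
    sumOver X (χ ∘ adj G u)
      ≡⟨ sumOver-remove X (χ ∘ adj G u) Xv ⟩
    χ (adj G u v) + sumOver (X ─ ⁅ v ⁆) (χ ∘ adj G u)
      ≡⟨ cong (χ (adj G u v) +_) (card-∩ (X ─ ⁅ v ⁆) (adj G u)) ⟨
    χ (adj G u v) + degIn (X ─ ⁅ v ⁆) u ∎
    where open ≡-Reasoning

  degSum-remove : ∀ X {v} → X v ≡ true → degSum X ≡ degSum (X ─ ⁅ v ⁆) + 2 * degIn (X ─ ⁅ v ⁆) v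
  degSum-remove X {v} Xv = begin
    sumOver X (degIn X)
      ≡⟨ sumOver-remove X (degIn X) Xv ⟩
    degIn X v + sumOver X′ (degIn X)
      ≡⟨ cong₂ _+_ (degIn-remove X v Xv) (sumOver-cong X′ (λ u _ → degIn-remove X u Xv)) ⟩
    (χ (adj G v v) + d) + sumOver X′ (λ u → χ (adj G u v) + degIn X′ u)
      ≡⟨ cong₂ _+_ (cong (λ b → χ b + d) (irrefl G v)) (sumOver-+ X′ _ (degIn X′)) ⟩
    d + (sumOver X′ (λ u → χ (adj G u v)) + degSum X′)
      ≡⟨ cong (λ e → d + (e + degSum X′)) edges-at-v ⟩
    d + (d + degSum X′)
      ≡⟨ rearrange d (degSum X′) ⟩
    degSum X′ + 2 * d ∎
    where
    open ≡-Reasoning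
    X′ = X ─ ⁅ v ⁆
    d = degIn X′ v
    rearrange : ∀ a b → a + (a + b) ≡ b + 2 * a
    rearrange = solve-∀
    edges-at-v : sumOver X′ (λ u → χ (adj G u v)) ≡ d
    edges-at-v = trans (sumOver-cong X′ (λ u _ → cong χ (symmetric G u v))) (sym (card-∩ X′ (adj G v)))

  another-neighbourIn : ∀ {X c} → 2 ≤ degIn X c → ∀ p →
                        ∃ λ w → X w ≡ true × adj G c w ≡ true × w ≢ p
  another-neighbourIn {X} {c} 2≤d p
    with any? (λ w → (X w Bool.≟ true) ×-dec (adj G c w Bool.≟ true) ×-dec ¬? (w ≟ p))
  ... | yes found = found
  ... | no  none  = contradiction (≤-trans 2≤d d≤1) λ { (s≤s ()) }
    where
    only-p : ∀ w → X w ∧ adj G c w ≡ true → ⁅ p ⁆ w ≡ true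
    only-p w XAw with X w in Xw | adj G c w in Aw | w ≟ p
    ... | true | true | yes _   = refl
    ... | true | true | no  w≢p = contradiction (w , Xw , Aw , w≢p) none
    d≤1 : degIn X c ≤ 1
    d≤1 = ≤-trans (card-⊆ (X ∩ adj G c) ⁅ p ⁆ only-p) (≤-reflexive (sumOver-⁅⁆ p (λ _ → 1)))

  minDegree≥2⇒walk : ∀ {X v₀} → X v₀ ≡ true → (∀ v → X v ≡ true → 2 ≤ degIn X v) →
                     NonBacktrackingWalk G
  minDegree≥2⇒walk {X} {v₀} Xv₀ minDeg = record
    { vertex = λ k → head (arcs k)
    ; adjacent = λ k → proj₁ (proj₂ (proj₂ (extend (arcs k))))
    ; nonBacktracking = λ k → proj₂ (proj₂ (proj₂ (extend (arcs (suc k)))))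
    }
    where
    Arc : Set
    Arc = Σ (Fin n × Fin n) λ tail,head → X (proj₂ tail,head) ≡ true
    tail head : Arc → Fin n
    tail a = proj₁ (proj₁ a)
    head a = proj₂ (proj₁ a)
    extend : (a : Arc) → ∃ λ w → X w ≡ true × adj G (head a) w ≡ true × w ≢ tail a
    extend a = another-neighbourIn (minDeg (head a) (proj₂ a)) (tail a)
    -- the degenerate arc (v₀ , v₀) lets the first step be an ordinary extension
    arcs : ℕ → Arc
    arcs zero    = (v₀ , v₀) , Xv₀
    arcs (suc k) = (head (arcs k) , proj₁ (extend (arcs k))) , proj₁ (proj₂ (extend (arcs k)))

  degSum-singleton : ∀ X → card X ≡ 1 → degSum X ≡ 0
  degSum-singleton X ∣X∣≡1 with card>0⇒nonempty X (subst (0 <_) (sym ∣X∣≡1) z<s)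
  ... | v , Xv = begin
    degSum X
      ≡⟨ degSum-remove X Xv ⟩
    degSum X′ + 2 * degIn X′ v
      ≡⟨ cong₂ (λ a b → a + 2 * b) (card≡0⇒sumOver≡0 X′ (degIn X′) ∣X′∣≡0) degIn≡0 ⟩
    0 ∎
    where
    open ≡-Reasoning
    X′ = X ─ ⁅ v ⁆
    ∣X′∣≡0 : card X′ ≡ 0
    ∣X′∣≡0 = suc-injective (trans (sym (card-remove X Xv)) ∣X∣≡1)
    degIn≡0 : degIn X′ v ≡ 0
    degIn≡0 = trans (card-∩ X′ (adj G v)) (card≡0⇒sumOver≡0 X′ (χ ∘ adj G v) ∣X′∣≡0)

  -- Deleting a vertex of X-degree at most 1 lowers the degree sum by at most 2; if X has no
  -- such vertex, it carries a non-backtracking walk and hence a cycle.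
  acyclic⇒degSum<2card : Acyclic G → ∀ X → 0 < card X → degSum X < 2 * card X
  acyclic⇒degSum<2card acyclic X ∣X∣>0 with k , 1+k≡∣X∣ ← m≤n⇒∃[o]m+o≡n ∣X∣>0 =
    subst (λ m → degSum X < 2 * m) 1+k≡∣X∣ (bound k X (sym 1+k≡∣X∣))
    where
    bound : ∀ k X → card X ≡ suc k → degSum X < 2 * suc k
    bound zero X ∣X∣≡1 = subst (_< 2) (sym (degSum-singleton X ∣X∣≡1)) z<s
    bound (suc k) X ∣X∣≡2+k with any? (λ v → (X v Bool.≟ true) ×-dec (degIn X v ≤? 1))
    ... | no  noLowDegree = contradiction (walk⇒cycle (minDegree≥2⇒walk Xv₀ minDeg)) acyclic
      where
      Xv₀ = proj₂ (card>0⇒nonempty X (subst (0 <_) (sym ∣X∣≡2+k) z<s))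
      minDeg : ∀ v → X v ≡ true → 2 ≤ degIn X v
      minDeg v Xv = ≰⇒> (λ d≤1 → noLowDegree (v , Xv , d≤1))
    ... | yes (v , Xv , d≤1) = begin-strict
      degSum X                              ≡⟨ degSum-remove X Xv ⟩
      degSum X′ + 2 * degIn X′ v            ≤⟨ +-monoʳ-≤ (degSum X′) (*-monoʳ-≤ 2 d′≤1) ⟩
      degSum X′ + 2                         <⟨ +-monoˡ-< 2 (bound k X′ ∣X′∣≡1+k) ⟩
      2 * suc k + 2                         ≡⟨ +-comm (2 * suc k) 2 ⟩
      2 + 2 * suc k                         ≡⟨ *-suc 2 (suc k) ⟨
      2 * suc (suc k) ∎
      where
      open ≤-Reasoning
      X′ = X ─ ⁅ v ⁆
      ∣X′∣≡1+k : card X′ ≡ suc k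
      ∣X′∣≡1+k = suc-injective (trans (sym (card-remove X Xv)) ∣X∣≡2+k)
      d′≤1 : degIn X′ v ≤ 1
      d′≤1 = ≤-trans (m≤n+m _ _) (≤-trans (≤-reflexive (sym (degIn-remove X v Xv))) d≤1)

  acyclic⇒card≤card-neighbourhood :
    Acyclic G → ∀ Y Z →
    (∀ y → Y y ≡ true → 2 ≤ deg y) →
    (∀ y → Y y ≡ true → ∀ w → adj G y w ≡ true → Z w ≡ true) →
    (∀ y → Y y ≡ true → Z y ≡ false) →
    card Y ≤ card Z
  acyclic⇒card≤card-neighbourhood acyclic Y Z deg≥2 N[Y]⊆Z Y∩Z≡∅ = ≮⇒≥ λ ∣Z∣<∣Y∣ →
    <-irrefl refl (begin-strict
      2 * card Y + 2 * card Y   ≤⟨ double-count ⟩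
      degSum X                  <⟨ acyclic⇒degSum<2card acyclic X (positive ∣Z∣<∣Y∣) ⟩
      2 * card X                ≡⟨ cong (2 *_) (split (λ _ → 1)) ⟩
      2 * (card Y + card Z)     <⟨ *-monoʳ-< 2 (+-monoʳ-< (card Y) ∣Z∣<∣Y∣) ⟩
      2 * (card Y + card Y)     ≡⟨ *-distribˡ-+ 2 (card Y) (card Y) ⟩
      2 * card Y + 2 * card Y ∎)
    where
    open ≤-Reasoning
    X = Y ∪ Z

    split : ∀ f → sumOver X f ≡ sumOver Y f + sumOver Z f
    split f = trans (sumOver-split X Y f) (cong₂ _+_ (sumOver-congˡ f X∩Y≗Y) (sumOver-congˡ f X─Y≗Z))
      where
      X∩Y≗Y : ∀ u → (X ∩ Y) u ≡ Y u
      X∩Y≗Y u with Y u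
      ... | true  = refl
      ... | false = ∧-zeroʳ (Z u)
      X─Y≗Z : ∀ u → (X ─ Y) u ≡ Z u
      X─Y≗Z u with Y u in Yu
      ... | true  = sym (Y∩Z≡∅ u Yu)
      ... | false = ∧-identityʳ (Z u)

    positive : card Z < card Y → 0 < card X
    positive ∣Z∣<∣Y∣ = ≤-trans (m<n⇒0<n ∣Z∣<∣Y∣)
                               (≤-trans (m≤m+n (card Y) (card Z)) (≤-reflexive (sym (split (λ _ → 1)))))

    Y⊆X : ∀ y → Y y ≡ true → X y ≡ true
    Y⊆X y Yy = cong (_∨ Z y) Yy

    N[Y]⊆X : ∀ y → Y y ≡ true → ∀ w → adj G y w ≡ true → X w ≡ true
    N[Y]⊆X y Yy w A = trans (cong (Y w ∨_) (N[Y]⊆Z y Yy w A)) (∨-zeroʳ (Y w))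

    2∣Y∣≤∑deg : 2 * card Y ≤ sumOver Y deg
    2∣Y∣≤∑deg = ≤-trans (≤-reflexive (*-distribˡ-sumOver 2 Y (λ _ → 1))) (sumOver-mono-≤ Y deg≥2)

    double-count : 2 * card Y + 2 * card Y ≤ degSum X
    double-count = begin
      2 * card Y + 2 * card Y
        ≤⟨ +-mono-≤ 2∣Y∣≤∑deg 2∣Y∣≤∑deg ⟩
      sumOver Y deg + sumOver Y deg
        ≡⟨ cong₂ _+_ (sumOver-cong Y λ y Yy → degIn-⊇-neighbours y (N[Y]⊆X y Yy))
                     (sumOver-cong Y λ y Yy → degIn-⊇-neighbours y (N[Y]⊆Z y Yy)) ⟨
      sumOver Y (degIn X) + sumOver Y (degIn Z)
        ≡⟨ cong (sumOver Y (degIn X) +_) (sumOver-degIn-comm Y Z) ⟩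
      sumOver Y (degIn X) + sumOver Z (degIn Y)
        ≤⟨ +-monoʳ-≤ (sumOver Y (degIn X)) (sumOver-mono-≤ Z λ z _ → degIn-⊆ z Y⊆X) ⟩
      sumOver Y (degIn X) + sumOver Z (degIn X)
        ≡⟨ split (degIn X) ⟨
      degSum X ∎

-- Leaves and supports

isSupport : ∀ {n} → Graph n → Fin n → Bool
isSupport G i = anyFin (λ j → adj G i j ∧ isLeaf G j)

anyFin⇒∃ : ∀ {n} (p : Fin n → Bool) → anyFin p ≡ true → ∃ λ j → p j ≡ true
anyFin⇒∃ {suc n} p any with p zero in p₀
... | true  = zero , p₀
... | false with anyFin⇒∃ (p ∘ suc) any
... | j , pj = suc j , pj

walk⇒neighbour : ∀ {n} {G : Graph n} {u w} → Walk G u w → u ≢ w → ∃ λ z → adj G u z ≡ true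
walk⇒neighbour here         u≢u = contradiction refl u≢u
walk⇒neighbour (step A _) _   = _ , A

module _ {n : ℕ} (G : Graph n) where

  degree≡deg : ∀ v → degree G v ≡ deg G v
  degree≡deg v = card-tabulate (adj G v)

  leaf⇒deg≡1 : ∀ {y} → isLeaf G y ≡ true → deg G y ≡ 1
  leaf⇒deg≡1 {y} leaf = trans (sym (degree≡deg y)) (≡ᵇ⇒≡ (degree G y) 1 (subst T (sym leaf) tt))

  nonLeaf⇒deg≢1 : ∀ {y} → isLeaf G y ≡ false → deg G y ≢ 1
  nonLeaf⇒deg≢1 {y} nonLeaf d≡1 = subst T nonLeaf (≡⇒≡ᵇ (degree G y) 1 (trans (degree≡deg y) d≡1))

  support⇒leaf-neighbour : ∀ {x} → isSupport G x ≡ true →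
                           ∃ λ y → isLeaf G y ≡ true × adj G x y ≡ true
  support⇒leaf-neighbour {x} Sx with anyFin⇒∃ (λ j → adj G x j ∧ isLeaf G j) Sx
  ... | y , AL with adj G x y in A
  ... | true = y , AL , A

  card-≤-leaf-partners : ∀ (P Q : Fin n → Bool) → (∀ y → Q y ≡ true → isLeaf G y ≡ true) →
                         (∀ x → P x ≡ true → ∃ λ y → Q y ≡ true × adj G x y ≡ true) →
                         card P ≤ card Q
  card-≤-leaf-partners P Q Q⊆L partner = card-≤-by-partner (adj G) partner one-partner
    where
    one-partner : ∀ y → Q y ≡ true → card (λ x → P x ∧ adj G x y) ≤ 1
    one-partner y Qy = ≤-trans (card-⊆ (λ x → P x ∧ adj G x y) (adj G y) partner-adj)
                               (≤-reflexive (leaf⇒deg≡1 (Q⊆L y Qy)))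
      where
      partner-adj : ∀ x → P x ∧ adj G x y ≡ true → adj G y x ≡ true
      partner-adj x PA with P x
      ... | true = trans (symmetric G y x) PA

connected⇒deg≥1 : ∀ {n} {G : Graph n} → Connected G → 2 ≤ n → ∀ v → 1 ≤ deg G v
connected⇒deg≥1 {G = G} connected (s≤s (s≤s z≤n)) v
  with z , A ← walk⇒neighbour (connected v (punchIn v zero)) (punchInᵢ≢i v zero ∘ sym)
  = ≤-sumOver (adj G v) (λ _ → 1) A

module _ {n : ℕ} {G : Graph n} (2≤n : 2 ≤ n) (tree : IsTree G) where

  nonLeaf⇒deg≥2 : ∀ v → isLeaf G v ≡ false → 2 ≤ deg G v
  nonLeaf⇒deg≥2 v nonLeaf =
    ≤∧≢⇒< (connected⇒deg≥1 (proj₁ tree) 2≤n v) (nonLeaf⇒deg≢1 G nonLeaf ∘ sym)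

  module _ (I : Fin n → Bool) (independent : ∀ x y → I x ≡ true → adj G x y ≡ true → I y ≡ false) where

    private
      L S : Fin n → Bool
      L = isLeaf G
      S = isSupport G

    ∣I─L∣≤∣∁I∣ : card (I ─ L) ≤ card (∁ I)
    ∣I─L∣≤∣∁I∣ = acyclic⇒card≤card-neighbourhood G (proj₂ tree) (I ─ L) (∁ I)
      (λ y I─Ly → nonLeaf⇒deg≥2 y (proj₂ (─-true I L I─Ly)))
      (λ y I─Ly w A → cong not (independent y w (proj₁ (─-true I L I─Ly)) A))
      (λ y I─Ly → cong not (proj₁ (─-true I L I─Ly)))

    ∣S∣≤∣L∣ : card S ≤ card L
    ∣S∣≤∣L∣ = card-≤-leaf-partners G S L (λ _ Ly → Ly) (λ _ → support⇒leaf-neighbour G)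

    ∣S∩I∣≤∣L─I∣ : card (S ∩ I) ≤ card (L ─ I)
    ∣S∩I∣≤∣L─I∣ = card-≤-leaf-partners G (S ∩ I) (L ─ I) (λ _ → proj₁ ∘ ─-true L I) partner
      where
      partner : ∀ x → (S ∩ I) x ≡ true → ∃ λ y → (L ─ I) y ≡ true × adj G x y ≡ true
      partner x S∩Ix with Sx , Ix ← ∩-true S I S∩Ix with y , Ly , A ← support⇒leaf-neighbour G Sx
        = y , cong₂ (λ l i → l ∧ not i) Ly (independent x y Ix A) , A

    ∣S─I∣≤∣∁I∣ : card (S ─ I) ≤ card (∁ I)
    ∣S─I∣≤∣∁I∣ = card-⊆ (S ─ I) (∁ I) (λ _ → cong not ∘ proj₂ ∘ ─-true S I)

    independent⇒3∣I∣+2∣S∣≤2[n+∣L∣] : 3 * card I + 2 * card S ≤ 2 * (n + card L)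
    independent⇒3∣I∣+2∣S∣≤2[n+∣L∣] =
      arithmetic (sumOver-split I L _) n≡∣I∣+∣∁I∣ ∣L∣-split (sumOver-split S I _)
                 ∣I─L∣≤∣∁I∣ ∣S∩I∣≤∣L─I∣ ∣S─I∣≤∣∁I∣ ∣S∣≤∣L∣
      where
      n≡∣I∣+∣∁I∣ : n ≡ card I + card (∁ I)
      n≡∣I∣+∣∁I∣ = trans (sym (card-⊤ n)) (sumOver-split (λ _ → true) I _)
      ∣L∣-split : card L ≡ card (I ∩ L) + card (L ─ I)
      ∣L∣-split = trans (sumOver-split L I _)
                        (cong (_+ card (L ─ I)) (sumOver-congˡ _ λ u → ∧-comm (L u) (I u)))
      arithmetic : ∀ {β s l m a b j k p q} → β ≡ a + b → m ≡ β + j → l ≡ a + k → s ≡ p + q →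
                   b ≤ j → p ≤ k → q ≤ j → s ≤ l → 3 * β + 2 * s ≤ 2 * (m + l)
      arithmetic {a = a} {b} {j} {k} {p} {q} refl refl refl refl b≤j p≤k q≤j s≤l = begin
        3 * (a + b) + 2 * (p + q)
          ≡⟨ regroup a b p q ⟩
        2 * (a + b) + b + (a + p + q) + (p + q)
          ≤⟨ +-mono-≤ (+-mono-≤ (+-monoʳ-≤ (2 * (a + b)) b≤j) (+-mono-≤ (+-monoʳ-≤ a p≤k) q≤j)) s≤l ⟩
        2 * (a + b) + j + (a + k + j) + (a + k)
          ≡⟨ collect a b j k ⟩
        2 * ((a + b + j) + (a + k)) ∎
        where
        open ≤-Reasoning
        regroup : ∀ a b p q → 3 * (a + b) + 2 * (p + q) ≡ 2 * (a + b) + b + (a + p + q) + (p + q)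
        regroup = solve-∀
        collect : ∀ a b j k → 2 * (a + b) + j + (a + k + j) + (a + k) ≡ 2 * ((a + b + j) + (a + k))
        collect = solve-∀

proposition2 : (n : ℕ) → 2 ≤ n → (T : Graph n) → IsTree T → (β : ℕ) → IsMaxIndep T β
    → 3 * β + 2 * ∣ Supp T ∣ ≤ 2 * (n + ∣ Deg₁ T ∣)
proposition2 n 2≤n T tree β maxIndep = begin
  3 * β + 2 * ∣ Supp T ∣
    ≡⟨ cong₂ (λ b s → 3 * b + 2 * s) β≡∣I∣ (card-tabulate (isSupport T)) ⟩
  3 * card I + 2 * card (isSupport T)
    ≤⟨ independent⇒3∣I∣+2∣S∣≤2[n+∣L∣] 2≤n tree I I-independent ⟩
  2 * (n + card (isLeaf T))
    ≡⟨ cong (λ l → 2 * (n + l)) (card-tabulate (isLeaf T)) ⟨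
  2 * (n + ∣ Deg₁ T ∣) ∎
  where
  open ≤-Reasoning
  open IsMaxIndep maxIndep
  I : Fin n → Bool
  I = lookup witness
  β≡∣I∣ : β ≡ card I
  β≡∣I∣ = trans (sym size) (trans (cong ∣_∣ (sym (tabulate∘lookup witness))) (card-tabulate I))
  I-independent : ∀ x y → I x ≡ true → adj T x y ≡ true → I y ≡ false
  I-independent x y Ix A with I y in Iy
  ... | true  = contradiction (trans (sym A) (indep x y (lookup⇒[]= x witness Ix) (lookup⇒[]= y witness Iy)))
                              λ ()
  ... | false = refl
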